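{- For every integer $\chi\geq 6$ and every positive integer $N$, there exists a family $\mathcal{F}$ of at least $N$ pairwise non-isomorphic graphs, each with chromatic number $\chi$ and without frozen vertices, such that $\mathcal{C}_\chi(G)\cong\mathcal{C}_\chi(G')$ for all $G,G'\in\mathcal{F}$.
   Context: All graphs are finite and simple. For a positive integer $k$, a (proper) $k$-colouring of $G$ is a map $V(G)\to[k]$ assigning different colours to adjacent vertices; $\chi(G)$ is the chromatic number. The $k$-recolouring graph $\mathcal{C}_k(G)$ has the $k$-colourings of $G$ as vertices, two being adjacent iff they differ at exactly one vertex of $G$. A vertex $v$ of $G$ is frozen if, for every $\chi(G)$-colouring of $G$, all $\chi(G)$ colours appear on the closed neighbourhood of $v$ (so $v$ can never be recoloured); otherwise $v$ is recolourable. -}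

module Defs where

open import Data.Nat using (ℕ; suc; _≥_)
open import Data.Fin using (Fin; _≟_)
open import Data.Bool using (Bool; true; false; T; _∧_; not)
open import Data.Vec using (Vec; lookup)
open import Data.List using (List; allFin)
open import Data.Bool.ListAction using (all)
open import Data.Product using (Σ; ∃; ∃-syntax; _×_; _,_)
open import Relation.Binary.PropositionalEquality using (_≡_; _≢_)
open import Relation.Nullary using (¬_)
open import Relation.Nullary.Decidable using (⌊_⌋)
open import Function.Bundles using (Inverse; _↔_; _⇔_)

record Graph : Set where
  field
    n     : ℕ
    adj   : Fin n → Fin n → Bool
    sym   : ∀ u v → adj u v ≡ adj v u
    irrefl : ∀ v → adj v v ≡ false
open Graph public

record _≅G_ (G H : Graph) : Set where
  field
    bij      : Fin (n G) ↔ Fin (n H)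
    preserve : ∀ u v → adj H (Inverse.to bij u) (Inverse.to bij v) ≡ adj G u v

-- A colouring with colours Fin k (the set [k]) assigned to vertices,
-- represented as a vector so that equality of colourings is ≡.
Colouring : Graph → ℕ → Set
Colouring G k = Vec (Fin k) (n G)

isProper : (G : Graph) {k : ℕ} → Colouring G k → Bool
isProper G c = all (λ u → all (λ v → not (adj G u v) Data.Bool.∨ not ⌊ lookup c u ≟ lookup c v ⌋) (allFin (n G))) (allFin (n G))
  where import Data.Bool

Proper : (G : Graph) {k : ℕ} → Colouring G k → Set
Proper G c = T (isProper G c)

ProperColouring : Graph → ℕ → Set
ProperColouring G k = Σ (Colouring G k) (Proper G)

DifferAtOne : (G : Graph) {k : ℕ} → Colouring G k → Colouring G k → Set
DifferAtOne G c d = ∃[ v ] (lookup c v ≢ lookup d v × (∀ u → u ≢ v → lookup c u ≡ lookup d u))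

RecAdj : (G : Graph) (k : ℕ) → ProperColouring G k → ProperColouring G k → Set
RecAdj G k (c , _) (d , _) = DifferAtOne G c d

record RecIso (k : ℕ) (G H : Graph) : Set where
  field
    bij      : ProperColouring G k ↔ ProperColouring H k
    preserve : ∀ α β → RecAdj G k α β ⇔ RecAdj H k (Inverse.to bij α) (Inverse.to bij β)

Colourable : Graph → ℕ → Set
Colourable G k = ProperColouring G k

HasChromaticNumber : Graph → ℕ → Set
HasChromaticNumber G 0       = Colourable G 0
HasChromaticNumber G (suc k) = Colourable G (suc k) × ¬ Colourable G k

Frozen : (G : Graph) (χ : ℕ) → Fin (n G) → Set
Frozen G χ v = ∀ (c : ProperColouring G χ) (a : Fin χ) →
  ∃[ u ] ((u ≡ v Data.Sum.⊎ adj G v u ≡ true) × lookup (Data.Product.proj₁ c) u ≡ a)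
  where import Data.Sum ; import Data.Product

NoFrozen : (G : Graph) (χ : ℕ) → Set
NoFrozen G χ = ∀ v → ¬ Frozen G χ v

-- The graphs are joins of the complement of the odd cycle C(2p+5), which needs p+3 colours and has no
-- frozen vertex, with N disjoint copies of a 9-vertex gadget H. Every proper 3-colouring of H gives the
-- non-adjacent vertices 1 and 2 different colours, and H has no 2-colouring; the i-th graph adds the edge 12
-- to the copies t < i. A colour class of the cycle complement is a clique of the (triangle-free) cycle, so
-- it has at most two vertices; hence a (p+6)-colouring spends at least p+3 colours on the cycle complement
-- and leaves at most 3 for each copy, which then respects the edge 12 anyway. So all graphs of the family
-- have the same proper (p+6)-colourings, and therefore the same recolouring graph, while their edge counts
-- differ. No vertex is frozen: the cycle complement is coloured by halving the index along a rotation,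
-- and colourings of H + 12 with a colour missing around a given vertex are found by exhaustive search.

module Submission where

open import Data.Bool using (Bool; true; false; T; not; _∧_; _∨_; if_then_else_)
open import Data.Bool.ListAction using (all; any)
open import Data.Bool.Properties using (T-∧; T-∨; T-≡; T-irrelevant; ∨-comm)
open import Data.Empty using (⊥; ⊥-elim)
open import Data.Fin as Fin
  using (Fin; zero; suc; toℕ; #_; _↑ˡ_; _↑ʳ_; splitAt; punchOut; punchIn; inject≤; lower₁; fromℕ<)
open import Data.Fin.Properties
  using (<-cmp; _<?_; any?; ¬Fin0; suc-injective; toℕ-injective; toℕ<n; toℕ-lower₁; lower₁-injective;
         toℕ-fromℕ<; fromℕ<-injective; ↑ˡ-injective; ↑ʳ-injective; splitAt-↑ˡ; splitAt-↑ʳ;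
         punchOut-injective; punchOut-cong; punchIn-injective; punchInᵢ≢i; inject≤-injective; +↔⊎; *↔×)
open import Data.List using (List; []; _∷_; allFin)
open import Data.List.Membership.Propositional using (_∈_)
import Data.List.Relation.Unary.All as All
import Data.List.Relation.Unary.All.Properties as All
open import Data.List.Relation.Unary.Any using (there; satisfied)
import Data.List.Relation.Unary.Any.Properties as Any
open import Data.Nat as ℕ using (ℕ; _+_; _*_; _≤_; _<_; _≥_; z≤n; s≤s; ⌊_/2⌋; ⌈_/2⌉)
import Data.Nat.Properties as ℕ
open import Algebra.Properties.CommutativeMonoid.Sum ℕ.+-0-commutativeMonoid using (sum; sum-permute; sum-cong-≗)
open import Data.Product using (Σ; ∃; ∃-syntax; _×_; _,_; proj₂)
open import Data.Product.Properties using (≡-dec)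
open import Data.Sum using (_⊎_; inj₁; inj₂; [_,_])
open import Data.Sum.Function.Propositional using (_⊎-↔_)
open import Data.Vec using (Vec; []; _∷_; lookup; tabulate)
open import Data.Vec.Properties using (lookup∘tabulate)
open import Defs hiding (sym)
open import Function using (_∘_; id; _$_; case_of_)
open import Function.Bundles using (Inverse; Equivalence; _↔_; mk↔ₛ′; mk⇔)
open import Function.Construct.Identity using (↔-id)
open import Function.Properties.Inverse using (↔-trans)
open import Relation.Binary.Definitions using (tri<; tri≈; tri>)
open import Relation.Binary.PropositionalEquality
  using (_≡_; _≢_; refl; sym; trans; cong; cong₂; subst; subst₂; module ≡-Reasoning)
open import Relation.Nullary using (¬_; yes; no; does; Dec; contradiction)
open import Relation.Nullary.Decidable
  using (toWitnessFalse; fromWitnessFalse; dec-true; dec-false; does-⇔; _⊎-dec_)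

private
  variable
    A B C C′ P V : Set
    k m r s : ℕ

T-all-allFin⁻ : (p : Fin m → Bool) → T (all p (allFin m)) → ∀ i → T (p i)
T-all-allFin⁻ p t = All.tabulate⁻ (All.all⁺ p _ t)

T-all-allFin⁺ : (p : Fin m → Bool) → (∀ i → T (p i)) → T (all p (allFin m))
T-all-allFin⁺ p h = All.all⁻ p (All.tabulate⁺ h)

T-implication⁻ : ∀ {a b} → T (not a ∨ b) → T a → T b
T-implication⁻ {true} t _ = t

T-implication⁺ : ∀ {a b} → (T a → T b) → T (not a ∨ b)
T-implication⁺ {true}  f = f _
T-implication⁺ {false} _ = _

T-not⇒¬T : ∀ {b} → T (not b) → ¬ T b
T-not⇒¬T {false} _ ()

T-does : (d : Dec P) → T (does d) → P
T-does (yes p) _ = p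

T-does⁺ : (d : Dec P) → P → T (does d)
T-does⁺ d p = subst T (sym (dec-true d p)) _

T-not-does : (d : Dec P) → T (not (does d)) → ¬ P
T-not-does (no ¬p) _ = ¬p

T-not-does⁺ : (d : Dec P) → ¬ P → T (not (does d))
T-not-does⁺ d ¬p = subst (T ∘ not) (sym (dec-false d ¬p)) _

-- Simple graphs on an arbitrary vertex type

record SimpleGraph (V : Set) : Set where
  field
    adjacent        : V → V → Bool
    adjacent-sym    : ∀ x y → adjacent x y ≡ adjacent y x
    adjacent-irrefl : ∀ x → adjacent x x ≡ false
open SimpleGraph public

record _⊆ᴳ_ (G H : SimpleGraph V) : Set where
  constructor edges-⊆
  field edge-⊆ : ∀ x y → T (adjacent G x y) → T (adjacent H x y)
open _⊆ᴳ_ public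

record ProperOn (G : SimpleGraph V) (κ : V → Fin k) : Set where
  constructor separating
  field separates : ∀ x y → T (adjacent G x y) → κ x ≢ κ y
open ProperOn public

ProperOn-cong : {G : SimpleGraph V} {κ κ′ : V → Fin k} →
                (∀ x → κ x ≡ κ′ x) → ProperOn G κ → ProperOn G κ′
ProperOn-cong κ≗κ′ p = separating λ x y xy →
  separates p x y xy ∘ subst₂ _≡_ (sym (κ≗κ′ x)) (sym (κ≗κ′ y))

ProperOn-⊆ : {G H : SimpleGraph V} {κ : V → Fin k} → G ⊆ᴳ H → ProperOn H κ → ProperOn G κ
ProperOn-⊆ G⊆H p = separating λ x y → separates p x y ∘ edge-⊆ G⊆H x y

record Unfrozen (G : SimpleGraph V) (k : ℕ) (x : V) : Set where
  field
    colouring      : V → Fin k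
    proper         : ProperOn G colouring
    absent         : Fin k
    absent-at      : colouring x ≢ absent
    absent-around  : ∀ y → T (adjacent G x y) → colouring y ≢ absent

Unfrozen-⊆ : {G H : SimpleGraph V} {x : V} → G ⊆ᴳ H → Unfrozen H k x → Unfrozen G k x
Unfrozen-⊆ {x = x} G⊆H w = record
  { colouring = colouring ; proper = ProperOn-⊆ G⊆H proper ; absent = absent
  ; absent-at = absent-at ; absent-around = λ y → absent-around y ∘ edge-⊆ G⊆H x y }
  where open Unfrozen w

AdjacencyPreserving : SimpleGraph V → (V → V) → Set
AdjacencyPreserving G σ = ∀ x y → adjacent G (σ x) (σ y) ≡ adjacent G x y

Unfrozen-pullback : {G : SimpleGraph V} {σ : V → V} {x : V} → AdjacencyPreserving G σ →
                    Unfrozen G k (σ x) → Unfrozen G k x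
Unfrozen-pullback {σ = σ} {x} aut w = record
  { colouring = colouring ∘ σ
  ; proper = separating λ y z → separates proper (σ y) (σ z) ∘ subst T (sym (aut y z))
  ; absent = absent ; absent-at = absent-at
  ; absent-around = λ y → absent-around (σ y) ∘ subst T (sym (aut x y)) }
  where open Unfrozen w

⊆ᴳ-refl : {G : SimpleGraph V} → G ⊆ᴳ G
⊆ᴳ-refl = edges-⊆ λ _ _ → id

-- Joins and disjoint unions

join : SimpleGraph A → SimpleGraph B → SimpleGraph (A ⊎ B)
join {A = A} {B} G H = record { adjacent = edge ; adjacent-sym = edge-sym ; adjacent-irrefl = edge-irrefl }
  where
    edge : A ⊎ B → A ⊎ B → Bool
    edge (inj₁ x) (inj₁ y) = adjacent G x y
    edge (inj₂ x) (inj₂ y) = adjacent H x y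
    edge _        _        = true
    edge-sym : ∀ u v → edge u v ≡ edge v u
    edge-sym (inj₁ x) (inj₁ y) = adjacent-sym G x y
    edge-sym (inj₁ x) (inj₂ y) = refl
    edge-sym (inj₂ x) (inj₁ y) = refl
    edge-sym (inj₂ x) (inj₂ y) = adjacent-sym H x y
    edge-irrefl : ∀ u → edge u u ≡ false
    edge-irrefl (inj₁ x) = adjacent-irrefl G x
    edge-irrefl (inj₂ y) = adjacent-irrefl H y

module _ {G G′ : SimpleGraph A} {H H′ : SimpleGraph B} where

  join-mono : G ⊆ᴳ G′ → H ⊆ᴳ H′ → join G H ⊆ᴳ join G′ H′
  join-mono G⊆G′ H⊆H′ = edges-⊆ λ where
    (inj₁ x) (inj₁ y) → edge-⊆ G⊆G′ x y
    (inj₁ x) (inj₂ y) → id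
    (inj₂ x) (inj₁ y) → id
    (inj₂ x) (inj₂ y) → edge-⊆ H⊆H′ x y

module _ {G : SimpleGraph A} {H : SimpleGraph B} {κ : A ⊎ B → Fin k} where

  join-proper⁺ : ProperOn G (κ ∘ inj₁) → ProperOn H (κ ∘ inj₂) →
                 (∀ x y → κ (inj₁ x) ≢ κ (inj₂ y)) → ProperOn (join G H) κ
  join-proper⁺ pG pH across = separating λ where
    (inj₁ x) (inj₁ y) → separates pG x y
    (inj₁ x) (inj₂ y) _ → across x y
    (inj₂ x) (inj₁ y) _ → across y x ∘ sym
    (inj₂ x) (inj₂ y) → separates pH x y

  join-properˡ : ProperOn (join G H) κ → ProperOn G (κ ∘ inj₁)
  join-properˡ p = separating λ x y → separates p (inj₁ x) (inj₁ y)

  join-properʳ : ProperOn (join G H) κ → ProperOn H (κ ∘ inj₂)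
  join-properʳ p = separating λ x y → separates p (inj₂ x) (inj₂ y)

  join-proper-across : ProperOn (join G H) κ → ∀ x y → κ (inj₁ x) ≢ κ (inj₂ y)
  join-proper-across p x y = separates p (inj₁ x) (inj₂ y) _

↑ˡ≢↑ʳ : ∀ {k₁ k₂} (i : Fin k₁) (j : Fin k₂) → i ↑ˡ k₂ ≢ k₁ ↑ʳ j
↑ˡ≢↑ʳ {k₁} {k₂} i j eq
  with () ← trans (sym (splitAt-↑ˡ k₁ i k₂)) (trans (cong (splitAt k₁) eq) (splitAt-↑ʳ k₁ k₂ j))

joinColouring : ∀ {k₁ k₂} → (A → Fin k₁) → (B → Fin k₂) → A ⊎ B → Fin (k₁ + k₂)
joinColouring {k₁ = k₁} {k₂} κ₁ κ₂ = [ (_↑ˡ k₂) ∘ κ₁ , (k₁ ↑ʳ_) ∘ κ₂ ]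

module _ {G : SimpleGraph A} {H : SimpleGraph B} {k₁ k₂ : ℕ} where

  joinColouring-proper : {κ₁ : A → Fin k₁} {κ₂ : B → Fin k₂} →
                         ProperOn G κ₁ → ProperOn H κ₂ → ProperOn (join G H) (joinColouring κ₁ κ₂)
  joinColouring-proper p₁ p₂ = join-proper⁺
    (separating λ x y xy → separates p₁ x y xy ∘ ↑ˡ-injective k₂ _ _)
    (separating λ x y xy → separates p₂ x y xy ∘ ↑ʳ-injective k₁ _ _)
    (λ x y → ↑ˡ≢↑ʳ _ _)

  join-unfrozenˡ : {x : A} {κ₂ : B → Fin k₂} →
                   Unfrozen G k₁ x → ProperOn H κ₂ → Unfrozen (join G H) (k₁ + k₂) (inj₁ x)
  join-unfrozenˡ {κ₂ = κ₂} w p₂ = record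
    { colouring = joinColouring colouring κ₂
    ; proper = joinColouring-proper proper p₂
    ; absent = absent ↑ˡ k₂
    ; absent-at = absent-at ∘ ↑ˡ-injective k₂ _ _
    ; absent-around = λ where
        (inj₁ y) xy → absent-around y xy ∘ ↑ˡ-injective k₂ _ _
        (inj₂ y) _ → ↑ˡ≢↑ʳ absent (κ₂ y) ∘ sym }
    where open Unfrozen w

  join-unfrozenʳ : {y : B} {κ₁ : A → Fin k₁} →
                   ProperOn G κ₁ → Unfrozen H k₂ y → Unfrozen (join G H) (k₁ + k₂) (inj₂ y)
  join-unfrozenʳ {κ₁ = κ₁} p₁ w = record
    { colouring = joinColouring κ₁ colouring
    ; proper = joinColouring-proper p₁ proper
    ; absent = k₁ ↑ʳ absent
    ; absent-at = absent-at ∘ ↑ʳ-injective k₁ _ _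
    ; absent-around = λ where
        (inj₁ x) _ → ↑ˡ≢↑ʳ (κ₁ x) absent
        (inj₂ x) yx → absent-around x yx ∘ ↑ʳ-injective k₁ _ _ }
    where open Unfrozen w

module _ {N : ℕ} where

  disjointUnion : (Fin N → SimpleGraph A) → SimpleGraph (Fin N × A)
  disjointUnion {A = A} G = record { adjacent = edge ; adjacent-sym = edge-sym ; adjacent-irrefl = edge-irrefl }
    where
      edge : Fin N × A → Fin N × A → Bool
      edge (s , x) (t , y) = does (s Fin.≟ t) ∧ adjacent (G s) x y
      edge-sym : ∀ u v → edge u v ≡ edge v u
      edge-sym (s , x) (t , y) with s Fin.≟ t | t Fin.≟ s
      ... | yes refl | yes _   = adjacent-sym (G s) x y
      ... | yes refl | no s≢s  = contradiction refl s≢s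
      ... | no s≢t   | yes t≡s = contradiction (sym t≡s) s≢t
      ... | no _     | no _    = refl
      edge-irrefl : ∀ u → edge u u ≡ false
      edge-irrefl (s , x) =
        trans (cong (_∧ adjacent (G s) x x) (dec-true (s Fin.≟ s) refl)) (adjacent-irrefl (G s) x)

  disjointUnion-adjacent-same : (G : Fin N → SimpleGraph A) → ∀ t x y →
                                adjacent (disjointUnion G) (t , x) (t , y) ≡ adjacent (G t) x y
  disjointUnion-adjacent-same G t x y = cong (_∧ adjacent (G t) x y) (dec-true (t Fin.≟ t) refl)

  disjointUnion-mono : {G H : Fin N → SimpleGraph A} →
                       (∀ t → G t ⊆ᴳ H t) → disjointUnion G ⊆ᴳ disjointUnion H
  disjointUnion-mono {G = G} {H} G⊆H = edges-⊆ mono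
    where
      mono : ∀ u v → T (adjacent (disjointUnion G) u v) → T (adjacent (disjointUnion H) u v)
      mono (s , x) (t , y) sxty with s Fin.≟ t
      ... | yes refl = edge-⊆ (G⊆H s) x y sxty

  module _ {G : Fin N → SimpleGraph A} {κ : Fin N × A → Fin k} where

    disjointUnion-proper⁺ : (∀ t → ProperOn (G t) (κ ∘ (t ,_))) → ProperOn (disjointUnion G) κ
    disjointUnion-proper⁺ p = separating separate
      where
        separate : ∀ u v → T (adjacent (disjointUnion G) u v) → κ u ≢ κ v
        separate (s , x) (t , y) sxty with s Fin.≟ t
        ... | yes refl = separates (p s) x y sxty

    disjointUnion-proper⁻ : ProperOn (disjointUnion G) κ → ∀ t → ProperOn (G t) (κ ∘ (t ,_))
    disjointUnion-proper⁻ p t = separating λ x y xy →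
      separates p (t , x) (t , y) (subst T (sym (disjointUnion-adjacent-same G t x y)) xy)

  disjointUnion-unfrozen : {G : SimpleGraph A} {x : A} → Unfrozen G k x → ∀ t →
                           Unfrozen (disjointUnion {A = A} λ _ → G) k (t , x)
  disjointUnion-unfrozen {G = G} {x} w t = record
    { colouring = colouring ∘ proj₂
    ; proper = disjointUnion-proper⁺ λ _ → proper
    ; absent = absent
    ; absent-at = absent-at
    ; absent-around = around }
    where
      open Unfrozen w
      around : ∀ v → T (adjacent (disjointUnion λ _ → G) (t , x) v) → colouring (proj₂ v) ≢ absent
      around (s , y) txsy with t Fin.≟ s
      ... | yes refl = absent-around y txsy

-- Graphs given by a list of edges, and exhaustive search over colourings

module _ {m : ℕ} where
  open import Data.List.Membership.DecPropositional {A = Fin m × Fin m} (≡-dec Fin._≟_ Fin._≟_) using (_∈?_)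

  fromEdges : List (Fin m × Fin m) → SimpleGraph (Fin m)
  fromEdges es = record
    { adjacent        = λ x y → not (does (x Fin.≟ y)) ∧ (does ((x , y) ∈? es) ∨ does ((y , x) ∈? es))
    ; adjacent-sym    = λ x y → cong₂ _∧_ (cong not (does-⇔ (mk⇔ sym sym) (x Fin.≟ y) (y Fin.≟ x)))
                                            (∨-comm (does ((x , y) ∈? es)) (does ((y , x) ∈? es)))
    ; adjacent-irrefl = λ x → cong (λ b → not b ∧ (does ((x , x) ∈? es) ∨ does ((x , x) ∈? es)))
                                   (dec-true (x Fin.≟ x) refl) }

  module _ {es : List (Fin m × Fin m)} {x y : Fin m} where

    fromEdges-adjacent⁺ : x ≢ y → (x , y) ∈ es → T (adjacent (fromEdges es) x y)
    fromEdges-adjacent⁺ x≢y xy∈es = Equivalence.from T-∧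
      (T-not-does⁺ (x Fin.≟ y) x≢y , Equivalence.from T-∨ (inj₁ (T-does⁺ ((x , y) ∈? es) xy∈es)))

    fromEdges-adjacent⁻ : T (adjacent (fromEdges es) x y) → x ≢ y × ((x , y) ∈ es ⊎ (y , x) ∈ es)
    fromEdges-adjacent⁻ xy with Equivalence.to T-∧ xy
    ... | x≢y , listed with Equivalence.to T-∨ listed
    ...   | inj₁ xy∈es = T-not-does (x Fin.≟ y) x≢y , inj₁ (T-does ((x , y) ∈? es) xy∈es)
    ...   | inj₂ yx∈es = T-not-does (x Fin.≟ y) x≢y , inj₂ (T-does ((y , x) ∈? es) yx∈es)

  fromEdges-mono : {es es′ : List (Fin m × Fin m)} →
                   (∀ {e} → e ∈ es → e ∈ es′) → fromEdges es ⊆ᴳ fromEdges es′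
  fromEdges-mono {es′ = es′} es⊆es′ = edges-⊆ λ x y xy → case fromEdges-adjacent⁻ xy of λ where
    (x≢y , inj₁ xy∈es) → fromEdges-adjacent⁺ x≢y (es⊆es′ xy∈es)
    (x≢y , inj₂ yx∈es) →
      subst T (adjacent-sym (fromEdges es′) y x) (fromEdges-adjacent⁺ (x≢y ∘ sym) (es⊆es′ yx∈es))

  respectsEdge : (Fin m → Fin k) → Fin m × Fin m → Bool
  respectsEdge κ (x , y) = does (x Fin.≟ y) ∨ not (does (κ x Fin.≟ κ y))

  respects : List (Fin m × Fin m) → (Fin m → Fin k) → Bool
  respects es κ = all (respectsEdge κ) es

  module _ {es : List (Fin m × Fin m)} {κ : Fin m → Fin k} where

    respects⇒proper : T (respects es κ) → ProperOn (fromEdges es) κ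
    respects⇒proper r = separating λ x y xy → case fromEdges-adjacent⁻ xy of λ where
        (x≢y , inj₁ xy∈es) → respected xy∈es x≢y
        (x≢y , inj₂ yx∈es) → respected yx∈es (x≢y ∘ sym) ∘ sym
      where
        respected : ∀ {x y} → (x , y) ∈ es → x ≢ y → κ x ≢ κ y
        respected {x} {y} e∈es x≢y =
          case Equivalence.to T-∨ (All.lookup (All.all⁺ (respectsEdge κ) es r) e∈es) of λ where
            (inj₁ x≡y)   → contradiction (T-does (x Fin.≟ y) x≡y) x≢y
            (inj₂ κx≢κy) → T-not-does (κ x Fin.≟ κ y) κx≢κy

    proper⇒respects : ProperOn (fromEdges es) κ → T (respects es κ)
    proper⇒respects p = All.all⁻ (respectsEdge κ) (All.tabulate λ {(x , y)} xy∈es → respected x y xy∈es)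
      where
        respected : ∀ x y → (x , y) ∈ es → T (respectsEdge κ (x , y))
        respected x y xy∈es with x Fin.≟ y
        ... | yes _   = _
        ... | no x≢y = T-not-does⁺ (κ x Fin.≟ κ y) (separates p x y (fromEdges-adjacent⁺ x≢y xy∈es))

  fromEdges-∷-proper : {es : List (Fin m × Fin m)} {κ : Fin m → Fin k} {x y : Fin m} →
                       ProperOn (fromEdges es) κ → κ x ≢ κ y → ProperOn (fromEdges ((x , y) ∷ es)) κ
  fromEdges-∷-proper {es = es} {κ} {x} {y} p κx≢κy = respects⇒proper {es = (x , y) ∷ es} $
    Equivalence.from T-∧ ( Equivalence.from T-∨ (inj₂ (T-not-does⁺ (κ x Fin.≟ κ y) κx≢κy))
                         , proper⇒respects {es = es} p )

every : ∀ n → (Vec (Fin k) n → Bool) → Bool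
every ℕ.zero    p = p []
every {k} (ℕ.suc n) p = all (λ x → every n (p ∘ (x ∷_))) (allFin k)

every-sound : ∀ n {p : Vec (Fin k) n → Bool} → T (every n p) → ∀ v → T (p v)
every-sound ℕ.zero    t []      = t
every-sound (ℕ.suc n) t (x ∷ v) = every-sound n (T-all-allFin⁻ _ t x) v

some : ∀ n → (Vec (Fin k) n → Bool) → Bool
some ℕ.zero    p = p []
some {k} (ℕ.suc n) p = any (λ x → some n (p ∘ (x ∷_))) (allFin k)

some-sound : ∀ n {p : Vec (Fin k) n → Bool} → T (some n p) → ∃ λ v → T (p v)
some-sound ℕ.zero    t = [] , t
some-sound {k} (ℕ.suc n) {p} t with satisfied (Any.any⁻ (λ x → some n (p ∘ (x ∷_))) (allFin k) t)
... | x , t′ with some-sound n t′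
...   | v , tv = x ∷ v , tv

module _ {m : ℕ} where

  absentOnClosedNeighbourhood : SimpleGraph (Fin m) → (Fin m → Fin k) → Fin k → Fin m → Bool
  absentOnClosedNeighbourhood G κ a x =
    all (λ y → not (does (x Fin.≟ y) ∨ adjacent G x y) ∨ not (does (κ y Fin.≟ a))) (allFin m)

  absentOnClosedNeighbourhood-sound : {G : SimpleGraph (Fin m)} {κ : Fin m → Fin k} {a : Fin k} {x : Fin m} →
                                      ProperOn G κ → T (absentOnClosedNeighbourhood G κ a x) → Unfrozen G k x
  absentOnClosedNeighbourhood-sound {G = G} {κ} {a} {x} p t = record
    { colouring     = κ
    ; proper        = p
    ; absent        = a
    ; absent-at     = absent-near x (Equivalence.from T-∨ (inj₁ (T-does⁺ (x Fin.≟ x) refl)))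
    ; absent-around = λ y xy → absent-near y (Equivalence.from T-∨ (inj₂ xy)) }
    where
      absent-near : ∀ y → T (does (x Fin.≟ y) ∨ adjacent G x y) → κ y ≢ a
      absent-near y near = T-not-does (κ y Fin.≟ a) (T-implication⁻ (T-all-allFin⁻ _ t y) near)

  unfrozen-by-search : {es : List (Fin m × Fin m)} {x : Fin m} →
                       T (some m λ v → respects es (lookup v) ∧
                                       any (λ a → absentOnClosedNeighbourhood (fromEdges es) (lookup v) a x) (allFin k)) →
                       Unfrozen (fromEdges es) k x
  unfrozen-by-search {k = k} {es} {x} t with some-sound m t
  ... | v , found with Equivalence.to T-∧ found
  ...   | proper , absent
          with satisfied (Any.any⁻ (λ a → absentOnClosedNeighbourhood (fromEdges es) (lookup v) a x) (allFin k) absent)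
  ...     | a , absent-a =
            absentOnClosedNeighbourhood-sound (respects⇒proper {es = es} {κ = lookup v} proper) absent-a

-- Realisation as a graph on Fin m

Proper⁻ : (G : Graph) (c : Colouring G k) → Proper G c → ∀ u v → T (adj G u v) → lookup c u ≢ lookup c v
Proper⁻ G c pc u v = toWitnessFalse ∘ T-implication⁻ (T-all-allFin⁻ _ (T-all-allFin⁻ _ pc u) v)

Proper⁺ : (G : Graph) (c : Colouring G k) →
          (∀ u v → T (adj G u v) → lookup c u ≢ lookup c v) → Proper G c
Proper⁺ G c h = T-all-allFin⁺ _ λ u → T-all-allFin⁺ _ λ v → T-implication⁺ (fromWitnessFalse ∘ h u v)

module _ (e : Fin m ↔ V) where
  open Inverse e

  toGraph : SimpleGraph V → Graph
  toGraph G = record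
    { n      = m
    ; adj    = λ u v → adjacent G (to u) (to v)
    ; sym    = λ u v → adjacent-sym G (to u) (to v)
    ; irrefl = λ u → adjacent-irrefl G (to u) }

  toGraph-Proper⁻ : (G : SimpleGraph V) (c : Vec (Fin k) m) →
                    Proper (toGraph G) c → ProperOn G (lookup c ∘ from)
  toGraph-Proper⁻ G c pc = separating λ x y xy → Proper⁻ (toGraph G) c pc (from x) (from y)
    (subst₂ (λ x′ y′ → T (adjacent G x′ y′)) (sym (strictlyInverseˡ x)) (sym (strictlyInverseˡ y)) xy)

  toGraph-Proper⁺ : (G : SimpleGraph V) (c : Vec (Fin k) m) →
                    ProperOn G (lookup c ∘ from) → Proper (toGraph G) c
  toGraph-Proper⁺ G c p = Proper⁺ (toGraph G) c λ u v uv →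
    subst₂ (λ u′ v′ → lookup c u′ ≢ lookup c v′) (strictlyInverseʳ u) (strictlyInverseʳ v)
           (separates p (to u) (to v) uv)

  colouringVector : (V → Fin k) → Vec (Fin k) m
  colouringVector κ = tabulate (κ ∘ to)

  lookup-colouringVector : (κ : V → Fin k) → ∀ x → lookup (colouringVector κ) (from x) ≡ κ x
  lookup-colouringVector κ x = trans (lookup∘tabulate (κ ∘ to) (from x)) (cong κ (strictlyInverseˡ x))

  toGraph-colourable : {G : SimpleGraph V} {κ : V → Fin k} → ProperOn G κ → Colourable (toGraph G) k
  toGraph-colourable {G = G} {κ} p =
    colouringVector κ , toGraph-Proper⁺ G (colouringVector κ) (ProperOn-cong (sym ∘ lookup-colouringVector κ) p)

  toGraph-not-colourable : {G : SimpleGraph V} →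
                           (∀ (κ : V → Fin k) → ¬ ProperOn G κ) → ¬ Colourable (toGraph G) k
  toGraph-not-colourable {G = G} none (c , pc) = none (lookup c ∘ from) (toGraph-Proper⁻ G c pc)

  transferProper : {G H : SimpleGraph V} → (∀ {κ : V → Fin k} → ProperOn G κ → ProperOn H κ) →
                   ProperColouring (toGraph G) k → ProperColouring (toGraph H) k
  transferProper {G = G} {H = H} G⇒H (c , pc) = c , toGraph-Proper⁺ H c (G⇒H (toGraph-Proper⁻ G c pc))

  toGraph-RecIso : {G H : SimpleGraph V} →
                   (∀ {κ : V → Fin k} → ProperOn G κ → ProperOn H κ) →
                   (∀ {κ : V → Fin k} → ProperOn H κ → ProperOn G κ) →
                   RecIso k (toGraph G) (toGraph H)
  toGraph-RecIso {G = G} {H = H} G⇒H H⇒G = record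
    { bij      = mk↔ₛ′ (transferProper {G = G} {H = H} G⇒H) (transferProper {G = H} {G} H⇒G)
                       (λ (c , _) → cong (c ,_) (T-irrelevant _ _)) (λ (c , _) → cong (c ,_) (T-irrelevant _ _))
    ; preserve = λ _ _ → mk⇔ id id }

  toGraph-NoFrozen : {G : SimpleGraph V} → (∀ x → Unfrozen G k x) → NoFrozen (toGraph G) k
  toGraph-NoFrozen {G = G} unfrozen v frozen = uncovered (frozen (toGraph-colourable proper) absent)
    where
      open Unfrozen (unfrozen (to v))
      uncovered : ¬ (∃[ u ] ((u ≡ v ⊎ adj (toGraph G) v u ≡ true) × lookup (colouringVector colouring) u ≡ absent))
      uncovered (u , inj₁ refl , cu≡a) = absent-at (trans (sym (lookup∘tabulate _ u)) cu≡a)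
      uncovered (u , inj₂ vu   , cu≡a) =
        absent-around (to u) (Equivalence.from T-≡ vu) (trans (sym (lookup∘tabulate _ u)) cu≡a)

-- Edge counts

sum-mono-≤ : {f g : Fin m → ℕ} → (∀ i → f i ≤ g i) → sum f ≤ sum g
sum-mono-≤ {m = ℕ.zero}  f≤g = z≤n
sum-mono-≤ {m = ℕ.suc m} f≤g = ℕ.+-mono-≤ (f≤g zero) (sum-mono-≤ (f≤g ∘ suc))

sum-mono-< : {f g : Fin m → ℕ} → (∀ i → f i ≤ g i) → ∀ i → f i < g i → sum f < sum g
sum-mono-< f≤g zero    f<g = ℕ.+-mono-<-≤ f<g (sum-mono-≤ (f≤g ∘ suc))
sum-mono-< f≤g (suc i) f<g = ℕ.+-mono-≤-< (f≤g zero) (sum-mono-< (f≤g ∘ suc) i f<g)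

indicator : Bool → ℕ
indicator b = if b then 1 else 0

indicator-mono : ∀ {a b} → (T a → T b) → indicator a ≤ indicator b
indicator-mono {false} _ = z≤n
indicator-mono {true} {true} _   = ℕ.≤-refl
indicator-mono {true} {false} a⇒b = contradiction _ a⇒b

indicator-mono-< : ∀ {a b} → ¬ T a → T b → indicator a < indicator b
indicator-mono-< {false} {true} _ _ = s≤s z≤n
indicator-mono-< {true}         ¬a _ = contradiction _ ¬a

edgeCount : Graph → ℕ
edgeCount G = sum λ u → sum λ v → indicator (adj G u v)

≅G⇒edgeCount≡ : {G H : Graph} → G ≅G H → edgeCount G ≡ edgeCount H
≅G⇒edgeCount≡ {G} {H} iso = sym $ begin
  edgeCount H
    ≡⟨ sum-permute (λ u → sum λ v → indicator (adj H u v)) bij ⟩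
  sum (λ u → sum λ v → indicator (adj H (to u) v))
    ≡⟨ sum-cong-≗ (λ u → sum-permute (λ v → indicator (adj H (to u) v)) bij) ⟩
  sum (λ u → sum λ v → indicator (adj H (to u) (to v)))
    ≡⟨ sum-cong-≗ (λ u → sum-cong-≗ λ v → cong indicator (preserve u v)) ⟩
  edgeCount G
    ∎
  where
    open ≡-Reasoning
    open _≅G_ iso
    open Inverse bij using (to)

increasing-edgeCount⇒nonIsomorphic : {N : ℕ} (F : Fin N → Graph) →
  (∀ {i j} → i Fin.< j → edgeCount (F i) < edgeCount (F j)) →
  ∀ i j → i ≢ j → ¬ (F i ≅G F j)
increasing-edgeCount⇒nonIsomorphic F increasing i j i≢j iso with <-cmp i j
... | tri< i<j _ _ = ℕ.<-irrefl (≅G⇒edgeCount≡ iso) (increasing i<j)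
... | tri≈ _ i≡j _ = i≢j i≡j
... | tri> _ _ j<i = ℕ.<-irrefl (sym (≅G⇒edgeCount≡ iso)) (increasing j<i)

toGraph-edgeCount-< : (e : Fin m ↔ V) {G H : SimpleGraph V} → G ⊆ᴳ H →
  ∀ x y → ¬ T (adjacent G x y) → T (adjacent H x y) → edgeCount (toGraph e G) < edgeCount (toGraph e H)
toGraph-edgeCount-< e {G} {H} G⊆H x y ¬Gxy Hxy =
  sum-mono-< (λ u → sum-mono-≤ (entry-≤ u)) (from x) (sum-mono-< (entry-≤ (from x)) (from y) entry-<)
  where
    open Inverse e
    entry-≤ : ∀ u v → indicator (adjacent G (to u) (to v)) ≤ indicator (adjacent H (to u) (to v))
    entry-≤ u v = indicator-mono (edge-⊆ G⊆H (to u) (to v))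
    entry-< : indicator (adjacent G (to (from x)) (to (from y))) < indicator (adjacent H (to (from x)) (to (from y)))
    entry-< rewrite strictlyInverseˡ x | strictlyInverseˡ y = indicator-mono-< ¬Gxy Hxy

-- Compressing colourings

record Recoding (g : C → Fin k) (r : ℕ) : Set where
  field
    recode           : C → Fin r
    recode-cong      : ∀ {x y} → g x ≡ g y → recode x ≡ recode y
    recode-injective : ∀ {x y} → recode x ≡ recode y → g x ≡ g y
open Recoding public

Recoding-id : (g : C → Fin k) → Recoding g k
Recoding-id g = record { recode = g ; recode-cong = id ; recode-injective = id }

Recoding-inject≤ : {g : C → Fin k} {r r′ : ℕ} → r ≤ r′ → Recoding g r → Recoding g r′
Recoding-inject≤ r≤r′ ρ = record
  { recode = λ x → inject≤ (recode ρ x) r≤r′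
  ; recode-cong = cong (λ i → inject≤ i r≤r′) ∘ recode-cong ρ
  ; recode-injective = recode-injective ρ ∘ inject≤-injective r≤r′ r≤r′ _ _ }

Recoding-punchOut : {g : C → Fin (ℕ.suc k)} {a : Fin (ℕ.suc k)} (a≢g : ∀ x → a ≢ g x) →
                    Recoding (λ x → punchOut (a≢g x)) r → Recoding g r
Recoding-punchOut {a = a} a≢g ρ = record
  { recode = recode ρ
  ; recode-cong = recode-cong ρ ∘ punchOut-cong a
  ; recode-injective = punchOut-injective (a≢g _) (a≢g _) ∘ recode-injective ρ }

Recoding-∘ : {g : C → Fin k} → Recoding g r → (σ : C′ → C) → Recoding (g ∘ σ) r
Recoding-∘ ρ σ = record
  { recode = recode ρ ∘ σ ; recode-cong = recode-cong ρ ; recode-injective = recode-injective ρ }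

Recoding-proper : {G : SimpleGraph C} {g : C → Fin k} (ρ : Recoding g r) →
                  ProperOn G g → ProperOn G (recode ρ)
Recoding-proper ρ p = separating λ x y xy → separates p x y xy ∘ recode-injective ρ

Compressible : (C → Fin k) → ℕ → Set
Compressible {k = k} g s = ∃[ r ] (s + r ≤ k × Recoding g r)

Compressible-mono : {g : C → Fin k} {s s′ : ℕ} → s ≤ s′ → Compressible g s′ → Compressible g s
Compressible-mono s≤s′ (r , bound , ρ) = r , ℕ.≤-trans (ℕ.+-monoˡ-≤ r s≤s′) bound , ρ

Compressible-punchOut : {g : C → Fin (ℕ.suc k)} {a : Fin (ℕ.suc k)} (a≢g : ∀ x → a ≢ g x) →
                        Compressible (λ x → punchOut (a≢g x)) s → Compressible g (ℕ.suc s)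
Compressible-punchOut a≢g (r , bound , ρ) = r , s≤s bound , Recoding-punchOut a≢g ρ

Compressible-∘ : {g : C → Fin k} → Compressible g s → (σ : C′ → C) → Compressible (g ∘ σ) s
Compressible-∘ (r , bound , ρ) σ = r , bound , Recoding-∘ ρ σ

Compressible⇒Recoding : {g : C → Fin k} → Compressible g s → k ≤ s + r → Recoding g r
Compressible⇒Recoding {s = s} (r′ , bound , ρ) k≤s+r =
  Recoding-inject≤ (ℕ.+-cancelˡ-≤ s _ _ (ℕ.≤-trans bound k≤s+r)) ρ

-- "Every proper colouring of G uses at least s colours", in the form needed for joins: whatever is
-- coloured with colours unused by a proper colouring of G can be recoded with s fewer colours.
Forces : SimpleGraph A → ℕ → Set₁
Forces {A = A} G s = ∀ {C : Set} {k} {f : A → Fin k} {g : C → Fin k} →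
                     ProperOn G f → (∀ a c → f a ≢ g c) → Compressible g s

join-compressible : {G : SimpleGraph C} {H : SimpleGraph A} {κ : C ⊎ A → Fin k} →
                    Forces H s → ProperOn (join G H) κ → Compressible (κ ∘ inj₁) s
join-compressible forces p = forces (join-properʳ p) λ a c → join-proper-across p c a ∘ sym

AtMostTwoPerColour : {n : ℕ} → (Fin n → Fin k) → Set
AtMostTwoPerColour f = ∀ {i j l} → i ≢ j → i ≢ l → j ≢ l → f i ≡ f j → f i ≡ f l → ⊥

AtMostTwoPerColour-reindex : {n n′ : ℕ} {f : Fin n → Fin k} {f′ : Fin n′ → Fin r}
  (σ : Fin n′ → Fin n) → (∀ {i j} → σ i ≡ σ j → i ≡ j) → (∀ {i j} → f′ i ≡ f′ j → f (σ i) ≡ f (σ j)) →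
  AtMostTwoPerColour f → AtMostTwoPerColour f′
AtMostTwoPerColour-reindex σ σ-injective f′⇒f two i≢j i≢l j≢l fi≡fj fi≡fl =
  two (i≢j ∘ σ-injective) (i≢l ∘ σ-injective) (j≢l ∘ σ-injective) (f′⇒f fi≡fj) (f′⇒f fi≡fl)

-- Remove the colour class of vertex zero, which has at most two elements, and recurse.
pairs⇒compressible : ∀ n {k} {f : Fin n → Fin k} {g : C → Fin k} →
                     AtMostTwoPerColour f → (∀ i c → f i ≢ g c) → Compressible g ⌈ n /2⌉
pairs⇒compressible ℕ.zero {k} {g = g} _ _ = k , ℕ.≤-refl , Recoding-id g
pairs⇒compressible (ℕ.suc n) {ℕ.zero} {f} _ _ = ⊥-elim (¬Fin0 (f zero))
pairs⇒compressible (ℕ.suc n) {ℕ.suc k} {f} {g} two avoid with any? (λ j → f (suc j) Fin.≟ f zero)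
... | no alone = Compressible-mono (s≤s (ℕ.⌊n/2⌋≤⌈n/2⌉ n))
      (Compressible-punchOut (avoid zero) (pairs⇒compressible n two′ avoid′))
  where
    f0≢f : ∀ i → f zero ≢ f (suc i)
    f0≢f i eq = alone (i , sym eq)
    f′ : Fin n → Fin k
    f′ i = punchOut (f0≢f i)
    two′ : AtMostTwoPerColour f′
    two′ = AtMostTwoPerColour-reindex suc suc-injective (punchOut-injective (f0≢f _) (f0≢f _)) two
    avoid′ : ∀ i c → f′ i ≢ punchOut (avoid zero c)
    avoid′ i c = avoid (suc i) c ∘ punchOut-injective (f0≢f i) (avoid zero c)
pairs⇒compressible (ℕ.suc (ℕ.suc n)) {ℕ.suc k} {f} {g} two avoid | yes (j , partner) =
  Compressible-punchOut (avoid zero) (pairs⇒compressible n two′ avoid′)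
  where
    rest : Fin n → Fin (ℕ.suc (ℕ.suc n))
    rest i = suc (punchIn j i)
    f0≢f : ∀ i → f zero ≢ f (rest i)
    f0≢f i = two (λ ()) (λ ()) (punchInᵢ≢i j i ∘ sym ∘ suc-injective) (sym partner)
    f′ : Fin n → Fin k
    f′ i = punchOut (f0≢f i)
    two′ : AtMostTwoPerColour f′
    two′ = AtMostTwoPerColour-reindex rest (punchIn-injective j _ _ ∘ suc-injective)
                                      (punchOut-injective (f0≢f _) (f0≢f _)) two
    avoid′ : ∀ i c → f′ i ≢ punchOut (avoid zero c)
    avoid′ i c = avoid (rest i) c ∘ punchOut-injective (f0≢f i) (avoid zero c)

-- Complements of cycles

module Cycle {ℓ : ℕ} where

  Vertex : Set
  Vertex = Fin (ℕ.suc ℓ)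

  next : Vertex → Vertex
  next i with ℓ ℕ.≟ toℕ i
  ... | yes _   = zero
  ... | no ℓ≢i = suc (lower₁ i ℓ≢i)

  next-last : {i : Vertex} → ℓ ≡ toℕ i → next i ≡ zero
  next-last {i} ℓ≡i with ℓ ℕ.≟ toℕ i
  ... | yes _   = refl
  ... | no ℓ≢i = contradiction ℓ≡i ℓ≢i

  toℕ-next : {i : Vertex} → ℓ ≢ toℕ i → toℕ (next i) ≡ ℕ.suc (toℕ i)
  toℕ-next {i} ℓ≢i with ℓ ℕ.≟ toℕ i
  ... | yes ℓ≡i = contradiction ℓ≡i ℓ≢i
  ... | no ℓ≢i = cong ℕ.suc (toℕ-lower₁ i ℓ≢i)

  next-injective : {i j : Vertex} → next i ≡ next j → i ≡ j
  next-injective {i} {j} eq with ℓ ℕ.≟ toℕ i | ℓ ℕ.≟ toℕ j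
  ... | yes ℓ≡i | yes ℓ≡j = toℕ-injective (trans (sym ℓ≡i) ℓ≡j)
  ... | no _    | no _    = lower₁-injective (suc-injective eq)
  next-injective () | yes _ | no _
  next-injective () | no _  | yes _

  next-of-successor : {i j : Vertex} → toℕ j ≡ ℕ.suc (toℕ i) → next i ≡ j
  next-of-successor {i} {j} j≡1+i = toℕ-injective (trans (toℕ-next ℓ≢i) (sym j≡1+i))
    where
      ℓ≢i : ℓ ≢ toℕ i
      ℓ≢i ℓ≡i = ℕ.<-irrefl refl
        (subst (_≤ ℓ) (trans j≡1+i (cong ℕ.suc (sym ℓ≡i))) (ℕ.s≤s⁻¹ (toℕ<n j)))

  next-induction : (P : Vertex → Set) → (∀ i → P (next i) → P i) → P zero → ∀ i → P i
  next-induction P step base i = go (ℓ ℕ.∸ toℕ i) i (ℕ.m+[n∸m]≡n (ℕ.s≤s⁻¹ (toℕ<n i)))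
    where
      go : ∀ d i → toℕ i + d ≡ ℓ → P i
      go ℕ.zero    i i+0≡ℓ = step i (subst P (sym (next-last (trans (sym i+0≡ℓ) (ℕ.+-identityʳ _)))) base)
      go (ℕ.suc d) i i+d≡ℓ =
        step i (go d (next i) (trans (cong (_+ d) (toℕ-next ℓ≢i)) (trans (sym (ℕ.+-suc _ d)) i+d≡ℓ)))
        where
          ℓ≢i : ℓ ≢ toℕ i
          ℓ≢i ℓ≡i = ℕ.m≢1+n+m (toℕ i) (trans (sym ℓ≡i) (trans (sym i+d≡ℓ) (ℕ.+-comm (toℕ i) (ℕ.suc d))))

  Consecutive : Vertex → Vertex → Set
  Consecutive i j = next i ≡ j ⊎ next j ≡ i

  Near : Vertex → Vertex → Set
  Near i j = i ≡ j ⊎ Consecutive i j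

  near? : ∀ i j → Dec (Near i j)
  near? i j = i Fin.≟ j ⊎-dec (next i Fin.≟ j ⊎-dec next j Fin.≟ i)

  near-sym : {i j : Vertex} → Near i j → Near j i
  near-sym (inj₁ i≡j)        = inj₁ (sym i≡j)
  near-sym (inj₂ (inj₁ i→j)) = inj₂ (inj₂ i→j)
  near-sym (inj₂ (inj₂ j→i)) = inj₂ (inj₁ j→i)

  near-next⁺ : {i j : Vertex} → Near i j → Near (next i) (next j)
  near-next⁺ (inj₁ i≡j)        = inj₁ (cong next i≡j)
  near-next⁺ (inj₂ (inj₁ i→j)) = inj₂ (inj₁ (cong next i→j))
  near-next⁺ (inj₂ (inj₂ j→i)) = inj₂ (inj₂ (cong next j→i))

  near-next⁻ : {i j : Vertex} → Near (next i) (next j) → Near i j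
  near-next⁻ (inj₁ eq)        = inj₁ (next-injective eq)
  near-next⁻ (inj₂ (inj₁ eq)) = inj₂ (inj₁ (next-injective eq))
  near-next⁻ (inj₂ (inj₂ eq)) = inj₂ (inj₂ (next-injective eq))

  near⇒consecutive : {i j : Vertex} → Near i j → i ≢ j → Consecutive i j
  near⇒consecutive (inj₁ i≡j)  i≢j = contradiction i≡j i≢j
  near⇒consecutive (inj₂ i~j) _   = i~j

  cycleComplement : SimpleGraph Vertex
  cycleComplement = record
    { adjacent        = λ i j → not (does (near? i j))
    ; adjacent-sym    = λ i j → cong not (does-⇔ (mk⇔ near-sym near-sym) (near? i j) (near? j i))
    ; adjacent-irrefl = λ i → cong not (dec-true (near? i i) (inj₁ refl)) }

  cycleComplement-adjacent⁺ : {i j : Vertex} → ¬ Near i j → T (adjacent cycleComplement i j)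
  cycleComplement-adjacent⁺ {i} {j} ¬near = subst (T ∘ not) (sym (dec-false (near? i j) ¬near)) _

  cycleComplement-adjacent⁻ : {i j : Vertex} → T (adjacent cycleComplement i j) → ¬ Near i j
  cycleComplement-adjacent⁻ {i} {j} ij near = subst (T ∘ not) (dec-true (near? i j) near) ij

  next-preserves-adjacency : AdjacencyPreserving cycleComplement next
  next-preserves-adjacency i j = cong not (does-⇔ (mk⇔ near-next⁻ near-next⁺) (near? (next i) (next j)) (near? i j))

  private
    wrap-at : {i j l : Vertex} → 3 ≤ ℓ → ℓ ≡ toℕ l → next i ≡ j → next j ≡ l → next l ≡ i → ⊥
    wrap-at {i} {j} {l} 3≤ℓ ℓ≡l i→j j→l l→i = ℕ.<-irrefl (sym ℓ≡2) 3≤ℓ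
      where
        open ≡-Reasoning
        ℓ≢0 : ℓ ≢ 0
        ℓ≢0 ℓ≡0 = ℕ.<-irrefl (sym ℓ≡0) (ℕ.≤-trans (s≤s z≤n) 3≤ℓ)
        j≡1 : toℕ j ≡ 1
        j≡1 = begin
          toℕ j            ≡⟨ cong toℕ (sym i→j) ⟩
          toℕ (next i)     ≡⟨ cong (toℕ ∘ next) (trans (sym l→i) (next-last ℓ≡l)) ⟩
          toℕ (next zero)  ≡⟨ toℕ-next ℓ≢0 ⟩
          1                ∎
        ℓ≢j : ℓ ≢ toℕ j
        ℓ≢j ℓ≡j = ℕ.<-irrefl (sym (trans ℓ≡j j≡1)) (ℕ.≤-trans (s≤s (s≤s z≤n)) 3≤ℓ)
        ℓ≡2 : ℓ ≡ 2
        ℓ≡2 = begin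
          ℓ                ≡⟨ ℓ≡l ⟩
          toℕ l            ≡⟨ cong toℕ (sym j→l) ⟩
          toℕ (next j)     ≡⟨ toℕ-next ℓ≢j ⟩
          ℕ.suc (toℕ j)    ≡⟨ cong ℕ.suc j≡1 ⟩
          2                ∎

  -- Only the step out of vertex ℓ wraps around to zero. Without a wrap the three steps add 3 to the index;
  -- a wrap at l forces i, j, l = 0, 1, 2 and hence ℓ = 2.
  no-directed-triangle : {i j l : Vertex} → 3 ≤ ℓ → next i ≡ j → next j ≡ l → next l ≡ i → ⊥
  no-directed-triangle {i} {j} {l} 3≤ℓ i→j j→l l→i =
    by-last (ℓ ℕ.≟ toℕ l) (ℓ ℕ.≟ toℕ i) (ℓ ℕ.≟ toℕ j)
    where
      open ≡-Reasoning
      by-last : Dec (ℓ ≡ toℕ l) → Dec (ℓ ≡ toℕ i) → Dec (ℓ ≡ toℕ j) → ⊥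
      by-last (yes ℓ≡l) _         _         = wrap-at 3≤ℓ ℓ≡l i→j j→l l→i
      by-last (no _)    (yes ℓ≡i) _         = wrap-at 3≤ℓ ℓ≡i j→l l→i i→j
      by-last (no _)    (no _)    (yes ℓ≡j) = wrap-at 3≤ℓ ℓ≡j l→i i→j j→l
      by-last (no ℓ≢l)  (no ℓ≢i)  (no ℓ≢j)  = ℕ.m≢1+n+m (toℕ i) (begin
        toℕ i                       ≡⟨ cong toℕ (sym l→i) ⟩
        toℕ (next l)                ≡⟨ toℕ-next ℓ≢l ⟩
        ℕ.suc (toℕ l)               ≡⟨ cong (ℕ.suc ∘ toℕ) (sym j→l) ⟩
        ℕ.suc (toℕ (next j))        ≡⟨ cong ℕ.suc (toℕ-next ℓ≢j) ⟩
        2 + toℕ j                   ≡⟨ cong ((2 +_) ∘ toℕ) (sym i→j) ⟩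
        2 + toℕ (next i)            ≡⟨ cong (2 +_) (toℕ-next ℓ≢i) ⟩
        3 + toℕ i                   ∎)

  private
    consecutive-after : {i j l : Vertex} → 3 ≤ ℓ → next i ≡ j →
                        Consecutive j l → Consecutive i l → i ≢ l → j ≢ l → ⊥
    consecutive-after 3≤ℓ i→j (inj₁ j→l) (inj₁ i→l) _   j≢l = j≢l (trans (sym i→j) i→l)
    consecutive-after 3≤ℓ i→j (inj₁ j→l) (inj₂ l→i) _   _   = no-directed-triangle 3≤ℓ i→j j→l l→i
    consecutive-after 3≤ℓ i→j (inj₂ l→j) _          i≢l _   = i≢l (next-injective (trans i→j (sym l→j)))

  no-consecutive-triangle : {i j l : Vertex} → 3 ≤ ℓ → i ≢ j → i ≢ l → j ≢ l →
                            Consecutive i j → Consecutive i l → Consecutive j l → ⊥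
  no-consecutive-triangle 3≤ℓ _ i≢l j≢l (inj₁ i→j) il jl = consecutive-after 3≤ℓ i→j jl il i≢l j≢l
  no-consecutive-triangle 3≤ℓ _ i≢l j≢l (inj₂ j→i) il jl = consecutive-after 3≤ℓ j→i il jl j≢l i≢l

  same-colour⇒near : {f : Vertex → Fin k} → ProperOn cycleComplement f → ∀ i j → f i ≡ f j → Near i j
  same-colour⇒near p i j fi≡fj with near? i j
  ... | yes near  = near
  ... | no ¬near = contradiction fi≡fj (separates p i j (cycleComplement-adjacent⁺ ¬near))

  cycleComplement-forces : 3 ≤ ℓ → Forces cycleComplement ⌈ ℕ.suc ℓ /2⌉
  cycleComplement-forces 3≤ℓ {f = f} p avoid = pairs⇒compressible (ℕ.suc ℓ) at-most-two avoid
    where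
      consecutive : ∀ {i j} → i ≢ j → f i ≡ f j → Consecutive i j
      consecutive {i} {j} i≢j fi≡fj = near⇒consecutive (same-colour⇒near p i j fi≡fj) i≢j
      at-most-two : AtMostTwoPerColour f
      at-most-two i≢j i≢l j≢l fi≡fj fi≡fl =
        no-consecutive-triangle 3≤ℓ i≢j i≢l j≢l (consecutive i≢j fi≡fj) (consecutive i≢l fi≡fl)
                                                (consecutive j≢l (trans (sym fi≡fj) fi≡fl))

⌊/2⌋-injective-up-to-1 : ∀ a b → ⌊ a /2⌋ ≡ ⌊ b /2⌋ → a ≡ b ⊎ b ≡ ℕ.suc a ⊎ a ≡ ℕ.suc b
⌊/2⌋-injective-up-to-1 0 0 _ = inj₁ refl
⌊/2⌋-injective-up-to-1 0 1 _ = inj₂ (inj₁ refl)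
⌊/2⌋-injective-up-to-1 1 0 _ = inj₂ (inj₂ refl)
⌊/2⌋-injective-up-to-1 1 1 _ = inj₁ refl
⌊/2⌋-injective-up-to-1 (ℕ.suc (ℕ.suc a)) (ℕ.suc (ℕ.suc b)) eq
  with ⌊/2⌋-injective-up-to-1 a b (ℕ.suc-injective eq)
... | inj₁ a≡b        = inj₁ (cong (2 +_) a≡b)
... | inj₂ (inj₁ b≡a) = inj₂ (inj₁ (cong (2 +_) b≡a))
... | inj₂ (inj₂ a≡b) = inj₂ (inj₂ (cong (2 +_) a≡b))
⌊/2⌋-injective-up-to-1 0 (ℕ.suc (ℕ.suc b)) ()
⌊/2⌋-injective-up-to-1 1 (ℕ.suc (ℕ.suc b)) ()
⌊/2⌋-injective-up-to-1 (ℕ.suc (ℕ.suc a)) 0 ()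
⌊/2⌋-injective-up-to-1 (ℕ.suc (ℕ.suc a)) 1 ()

⌈/2⌉≡0⇒≡0 : ∀ a → ⌈ a /2⌉ ≡ 0 → a ≡ 0
⌈/2⌉≡0⇒≡0 0 _ = refl

module OddCycle (m : ℕ) where
  open Cycle {m + m} public

  -- Colour ⌈ i/2⌉: the classes are {0}, {1, 2}, …, {2m-1, 2m}, so colour 0 is missing around next zero = 1.
  halfColour : Vertex → Fin (ℕ.suc m)
  halfColour i = fromℕ< {⌈ toℕ i /2⌉} (s≤s (subst (⌈ toℕ i /2⌉ ≤_) (sym (ℕ.n≡⌈n+n/2⌉ m))
                                                  (ℕ.⌈n/2⌉-mono (ℕ.s≤s⁻¹ (toℕ<n i)))))

  halfColour-proper : ProperOn cycleComplement halfColour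
  halfColour-proper = separating λ i j ij eq →
    cycleComplement-adjacent⁻ ij (near (⌊/2⌋-injective-up-to-1 _ _ (fromℕ<-injective _ _ _ _ eq)))
    where
      near : ∀ {i j} → ℕ.suc (toℕ i) ≡ ℕ.suc (toℕ j) ⊎ ℕ.suc (toℕ j) ≡ 2 + toℕ i ⊎ ℕ.suc (toℕ i) ≡ 2 + toℕ j →
             Near i j
      near (inj₁ eq)        = inj₁ (toℕ-injective (ℕ.suc-injective eq))
      near (inj₂ (inj₁ eq)) = inj₂ (inj₁ (next-of-successor (ℕ.suc-injective eq)))
      near (inj₂ (inj₂ eq)) = inj₂ (inj₂ (next-of-successor (ℕ.suc-injective eq)))

  halfColour≡0 : ∀ i → halfColour i ≡ zero → i ≡ zero
  halfColour≡0 i eq = toℕ-injective (⌈/2⌉≡0⇒≡0 (toℕ i) (trans (sym (toℕ-fromℕ< _)) (cong toℕ eq)))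

  unfrozen : 1 ≤ m → ∀ i → Unfrozen cycleComplement (ℕ.suc m) i
  unfrozen 1≤m = next-induction (Unfrozen cycleComplement (ℕ.suc m)) (λ _ → rotate) (rotate at-next-zero)
    where
      rotate : ∀ {i} → Unfrozen cycleComplement (ℕ.suc m) (next i) → Unfrozen cycleComplement (ℕ.suc m) i
      rotate = Unfrozen-pullback {σ = next} next-preserves-adjacency
      next-zero≢zero : next zero ≢ zero
      next-zero≢zero eq = ℕ.1+n≢0 (trans (sym (toℕ-next m+m≢0)) (cong toℕ eq))
        where
          m+m≢0 : m + m ≢ 0
          m+m≢0 m+m≡0 = ℕ.<-irrefl (sym m+m≡0) (ℕ.+-mono-≤ 1≤m z≤n)
      at-next-zero : Unfrozen cycleComplement (ℕ.suc m) (next zero)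
      at-next-zero = record
        { colouring     = halfColour
        ; proper        = halfColour-proper
        ; absent        = zero
        ; absent-at     = next-zero≢zero ∘ halfColour≡0 (next zero)
        ; absent-around = λ y adjacent c≡0 → cycleComplement-adjacent⁻ adjacent
                            (inj₂ (inj₂ (cong next (halfColour≡0 y c≡0)))) }

  forces : 2 ≤ m → Forces cycleComplement (ℕ.suc m)
  forces 2≤m = subst (Forces cycleComplement) (cong ℕ.suc (sym (ℕ.n≡⌊n+n/2⌋ m)))
                     (cycleComplement-forces (ℕ.≤-trans (ℕ.n≤1+n 3) (ℕ.+-mono-≤ 2≤m 2≤m)))

-- The gadget

gadgetEdges : List (Fin 9 × Fin 9)
gadgetEdges = (# 0 , # 5) ∷ (# 0 , # 6) ∷ (# 0 , # 8) ∷ (# 1 , # 3) ∷ (# 1 , # 6)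
            ∷ (# 2 , # 4) ∷ (# 2 , # 5) ∷ (# 2 , # 7) ∷ (# 3 , # 5) ∷ (# 3 , # 7)
            ∷ (# 3 , # 8) ∷ (# 4 , # 6) ∷ (# 4 , # 8) ∷ (# 6 , # 7) ∷ []

gadget : SimpleGraph (Fin 9)
gadget = fromEdges gadgetEdges

gadget⁺ : SimpleGraph (Fin 9)
gadget⁺ = fromEdges ((# 1 , # 2) ∷ gadgetEdges)

gadget⁺-unfrozen : ∀ x → Unfrozen gadget⁺ 3 x
gadget⁺-unfrozen = unfrozen-by-search {es = (# 1 , # 2) ∷ gadgetEdges} ∘ T-all-allFin⁻ search-at search-succeeds
  where
    search-at : Fin 9 → Bool
    search-at x = some 9 λ v → respects ((# 1 , # 2) ∷ gadgetEdges) (lookup v) ∧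
                               any (λ a → absentOnClosedNeighbourhood gadget⁺ (lookup v) a x) (allFin 3)
    search-succeeds : T (all search-at (allFin 9))
    search-succeeds = _

gadget-separates : (h : Fin 9 → Fin 3) → ProperOn gadget h → h (# 1) ≢ h (# 2)
gadget-separates h p = subst₂ _≢_ (lookup∘tabulate h (# 1)) (lookup∘tabulate h (# 2))
  (T-not-does (lookup v (# 1) Fin.≟ lookup v (# 2))
    (T-implication⁻ (every-sound 9 {separated-if-proper} exhaustive v)
                    (proper⇒respects {es = gadgetEdges} (ProperOn-cong (sym ∘ lookup∘tabulate h) p))))
  where
    v = tabulate h
    separated-if-proper : Vec (Fin 3) 9 → Bool
    separated-if-proper v =
      not (respects gadgetEdges (lookup v)) ∨ not (does (lookup v (# 1) Fin.≟ lookup v (# 2)))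
    -- decided by evaluating the check on all 3⁹ colour vectors
    exhaustive : T (every 9 separated-if-proper)
    exhaustive = _

gadget-not-2-colourable : (h : Fin 9 → Fin 2) → ¬ ProperOn gadget h
gadget-not-2-colourable h p =
  T-not⇒¬T (every-sound 9 {improper} exhaustive (tabulate h))
           (proper⇒respects {es = gadgetEdges} (ProperOn-cong (sym ∘ lookup∘tabulate h) p))
  where
    improper : Vec (Fin 2) 9 → Bool
    improper v = not (respects gadgetEdges (lookup v))
    exhaustive : T (every 9 improper)
    exhaustive = _

gadget⊆gadget⁺ : gadget ⊆ᴳ gadget⁺
gadget⊆gadget⁺ = fromEdges-mono {es = gadgetEdges} {es′ = (# 1 , # 2) ∷ gadgetEdges} there

gadgetIf : {P : Set} → Dec P → SimpleGraph (Fin 9)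
gadgetIf (yes _) = gadget⁺
gadgetIf (no _)  = gadget

gadget⊆gadgetIf : {P : Set} (d : Dec P) → gadget ⊆ᴳ gadgetIf d
gadget⊆gadgetIf (yes _) = gadget⊆gadget⁺
gadget⊆gadgetIf (no _)  = ⊆ᴳ-refl

gadgetIf⊆gadget⁺ : {P : Set} (d : Dec P) → gadgetIf d ⊆ᴳ gadget⁺
gadgetIf⊆gadget⁺ (yes _) = ⊆ᴳ-refl
gadgetIf⊆gadget⁺ (no _)  = gadget⊆gadget⁺

gadgetIf-edge : {P : Set} (d : Dec P) → adjacent (gadgetIf d) (# 1) (# 2) ≡ does d
gadgetIf-edge (yes _) = refl
gadgetIf-edge (no _)  = refl

gadgetIf-mono : {P Q : Set} → (P → Q) → (d : Dec P) (d′ : Dec Q) → gadgetIf d ⊆ᴳ gadgetIf d′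
gadgetIf-mono P⇒Q (yes _) (yes _)  = ⊆ᴳ-refl
gadgetIf-mono P⇒Q (yes p) (no ¬q)  = contradiction (P⇒Q p) ¬q
gadgetIf-mono P⇒Q (no _)  d′       = gadget⊆gadgetIf d′

-- The family

module Construction (p N : ℕ) where
  open OddCycle (2 + p) using (cycleComplement; halfColour-proper; unfrozen; forces)
    renaming (Vertex to CycleVertex)

  Vertex : Set
  Vertex = (Fin N × Fin 9) ⊎ CycleVertex

  variant : Fin N → Fin N → SimpleGraph (Fin 9)
  variant i t = gadgetIf (t <? i)

  family : Fin N → SimpleGraph Vertex
  family i = join (disjointUnion (variant i)) cycleComplement

  saturated : SimpleGraph Vertex
  saturated = join (disjointUnion λ _ → gadget⁺) cycleComplement

  family⊆saturated : ∀ i → family i ⊆ᴳ saturated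
  family⊆saturated i = join-mono (disjointUnion-mono λ t → gadgetIf⊆gadget⁺ (t <? i)) ⊆ᴳ-refl

  family-mono : ∀ {i j} → i Fin.≤ j → family i ⊆ᴳ family j
  family-mono {i} {j} i≤j =
    join-mono (disjointUnion-mono λ t → gadgetIf-mono (λ t<i → ℕ.<-≤-trans t<i i≤j) (t <? i) (t <? j)) ⊆ᴳ-refl

  family-extra-edge : ∀ i t → adjacent (family i) (inj₁ (t , # 1)) (inj₁ (t , # 2)) ≡ does (t <? i)
  family-extra-edge i t = trans (disjointUnion-adjacent-same (variant i) t (# 1) (# 2)) (gadgetIf-edge (t <? i))

  cycle-forces : Forces cycleComplement (3 + p)
  cycle-forces = forces (s≤s (s≤s z≤n))

  copy-proper : ∀ i {k} {κ : Vertex → Fin k} → ProperOn (family i) κ →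
                ∀ t → ProperOn gadget (λ y → κ (inj₁ (t , y)))
  copy-proper i pκ t = ProperOn-⊆ (gadget⊆gadgetIf (t <? i)) (disjointUnion-proper⁻ (join-properˡ pκ) t)

  copy-recoding : ∀ i {k r} {κ : Vertex → Fin k} → ProperOn (family i) κ → k ≤ (3 + p) + r →
                  ∀ t → Recoding (λ y → κ (inj₁ (t , y))) r
  copy-recoding i pκ k≤ t =
    Compressible⇒Recoding (Compressible-∘ (join-compressible cycle-forces pκ) (t ,_)) k≤

  copies-separated : ∀ i {κ : Vertex → Fin (6 + p)} → ProperOn (family i) κ →
                     ∀ t → κ (inj₁ (t , # 1)) ≢ κ (inj₁ (t , # 2))
  copies-separated i pκ t =
    gadget-separates (recode ρ) (Recoding-proper ρ (copy-proper i pκ t)) ∘ recode-cong ρ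
    where ρ = copy-recoding i pκ (ℕ.≤-reflexive (ℕ.+-comm 3 (3 + p))) t

  saturated-proper : ∀ i {κ : Vertex → Fin (6 + p)} → ProperOn (family i) κ → ProperOn saturated κ
  saturated-proper i pκ = join-proper⁺
    (disjointUnion-proper⁺ λ t →
      fromEdges-∷-proper {es = gadgetEdges} (copy-proper i pκ t) (copies-separated i pκ t))
    (join-properʳ pκ) (join-proper-across pκ)

  family-not-colourable : ∀ i (κ : Vertex → Fin (5 + p)) → ¬ ProperOn (family i) κ
  family-not-colourable i κ pκ = gadget-not-2-colourable (recode ρ) (Recoding-proper ρ (copy-proper i pκ i))
    where ρ = copy-recoding i pκ (ℕ.≤-reflexive (ℕ.+-comm 2 (3 + p))) i

  saturated-unfrozen : ∀ x → Unfrozen saturated (6 + p) x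
  saturated-unfrozen (inj₁ (t , y)) =
    join-unfrozenˡ (disjointUnion-unfrozen (gadget⁺-unfrozen y) t) halfColour-proper
  saturated-unfrozen (inj₂ a) =
    join-unfrozenʳ (disjointUnion-proper⁺ λ _ → Unfrozen.proper (gadget⁺-unfrozen zero)) (unfrozen (s≤s z≤n) a)

  encoding : Fin (N * 9 + ℕ.suc ((2 + p) + (2 + p))) ↔ Vertex
  encoding = ↔-trans +↔⊎ (*↔× ⊎-↔ ↔-id _)

  graph : Fin N → Graph
  graph i = toGraph encoding (family i)

  graph-nonIsomorphic : ∀ i j → i ≢ j → ¬ (graph i ≅G graph j)
  graph-nonIsomorphic = increasing-edgeCount⇒nonIsomorphic graph λ {i} {j} i<j →
    toGraph-edgeCount-< encoding (family-mono (ℕ.<⇒≤ i<j)) (inj₁ (i , # 1)) (inj₁ (i , # 2))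
      (subst T (trans (family-extra-edge i i) (dec-false (i <? i) (ℕ.<-irrefl refl))))
      (subst T (sym (trans (family-extra-edge j i) (dec-true (i <? j) i<j))) _)

  graph-chromatic : ∀ i → HasChromaticNumber (graph i) (6 + p)
  graph-chromatic i =
      toGraph-colourable encoding (ProperOn-⊆ (family⊆saturated i) (Unfrozen.proper (saturated-unfrozen (inj₂ zero))))
    , toGraph-not-colourable encoding (family-not-colourable i)

  graph-noFrozen : ∀ i → NoFrozen (graph i) (6 + p)
  graph-noFrozen i = toGraph-NoFrozen encoding (Unfrozen-⊆ (family⊆saturated i) ∘ saturated-unfrozen)

  graph-recIso : ∀ i j → RecIso (6 + p) (graph i) (graph j)
  graph-recIso i j = toGraph-RecIso encoding (ProperOn-⊆ (family⊆saturated j) ∘ saturated-proper i)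
                                             (ProperOn-⊆ (family⊆saturated i) ∘ saturated-proper j)

theorem1p4 : ∀ (χ : ℕ) → χ ≥ 6 → ∀ (N : ℕ) → N ≥ 1 →
    Σ (Fin N → Graph) λ F →
      (∀ i j → i ≢ j → ¬ (F i ≅G F j))
      × (∀ i → HasChromaticNumber (F i) χ × NoFrozen (F i) χ)
      × (∀ i j → RecIso χ (F i) (F j))
theorem1p4 _ (s≤s (s≤s (s≤s (s≤s (s≤s (s≤s (z≤n {p}))))))) N _ =
  graph , graph-nonIsomorphic , (λ i → graph-chromatic i , graph-noFrozen i) , graph-recIso
  where open Construction p N
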